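{- Let $u_0\geq 1$ and $r\geq 1$ be integers with $\gcd(u_0,r)=1$, let $n\geq 0$ be an integer, and set $u_j:=u_0+jr$ for $0\leq j\leq n$ and $L_n:=\operatorname{lcm}(u_0,u_1,\ldots,u_n)$. Then for every integer $k$ with $0\leq k\leq n$, $$L_n \geq \frac{u_k u_{k+1}\cdots u_n}{(n-k)!}\prod_{p\mid r}\left(\frac{p^{(n-k)/(p-1)}}{n-k+1}\right),$$ where the product runs over the primes $p$ dividing $r$ (and is $1$ if $r=1$). -}

module Defs where

open import Data.Nat using (ℕ; suc; _+_; _*_; _∸_; _^_; _!)
open import Data.Nat.LCM using (lcm)
open import Data.Nat.Divisibility using (_∣?_)
open import Data.Nat.Primality using (prime?)
open import Data.List using (List; map; foldr; filter; upTo; length)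
open import Data.Nat.ListAction using (product)
open import Relation.Nullary.Decidable using (_×-dec_; ¬?)
open import Data.Nat using (_≟_)

u : ℕ → ℕ → ℕ → ℕ
u u₀ r j = u₀ + j * r

lcmList : List ℕ → ℕ
lcmList = foldr lcm 1

L : ℕ → ℕ → ℕ → ℕ
L u₀ r n = lcmList (map (u u₀ r) (upTo (suc n)))

prodFrom : ℕ → ℕ → ℕ → ℕ → ℕ
prodFrom u₀ r k n = product (map (λ i → u u₀ r (k + i)) (upTo (suc (n ∸ k))))

primeDivisors : ℕ → List ℕ
primeDivisors r = filter (λ p → prime? p ×-dec (p ∣? r)) (upTo (suc r))

-- D = ∏_{p ∣ r} (p - 1): common denominator of the exponents (n-k)/(p-1)
denom : ℕ → ℕ
denom r = product (map (λ p → p ∸ 1) (primeDivisors r))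

-- ∏_{q ∣ r, q ≠ p} (q - 1) = D / (p - 1)
others : ℕ → ℕ → ℕ
others r p = product (map (λ q → q ∸ 1) (filter (λ q → ¬? (q ≟ p)) (primeDivisors r)))

-- ∏_{p ∣ r} p^{m D/(p-1)}  =  (∏_{p ∣ r} p^{m/(p-1)})^D
primePowProd : ℕ → ℕ → ℕ
primePowProd r m = product (map (λ p → p ^ (m * others r p)) (primeDivisors r))

ω : ℕ → ℕ
ω r = length (primeDivisors r)

{-# OPTIONS --safe #-}
module Submission where

-- With m = n − k, the partial-fraction expansion of 1/(u_k ⋯ u_n) shows that u_k ⋯ u_n divides
-- L_n · m! · r^m. Every u_j is coprime to r, so both r^m and the part ∏_{p∣r} p^{e_p} of m! can be
-- cancelled: u_k ⋯ u_n · ∏_{p∣r} p^{e_p} divides L_n · m!. Legendre's formula provides exponents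
-- with p^{e_p} (m+1) ≥ p^{m/(p−1)}, and raising everything to the power D = ∏_{p∣r} (p − 1) makes
-- the exponents m/(p−1) integral.

open import Data.List using (List; []; _∷_; [_]; _∷ʳ_; applyUpTo; map; filter; upTo; length)
open import Data.List.Properties
  using (applyUpTo-∷ʳ; map-upTo; filter-all; filter-accept; filter-reject)
open import Data.List.Membership.Propositional using (_∈_)
open import Data.List.Membership.Propositional.Properties using (∈-map⁺; ∈-upTo⁺)
open import Data.List.Relation.Unary.Any using (here; there)
open import Data.List.Relation.Unary.All as All using (All; []; _∷_)
import Data.List.Relation.Unary.All.Properties as All
open import Data.List.Relation.Unary.AllPairs as AllPairs using (AllPairs; []; _∷_)
import Data.List.Relation.Unary.AllPairs.Properties as AllPairs
open import Data.List.Relation.Unary.Unique.Propositional using (Unique)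
import Data.List.Relation.Unary.Unique.Propositional.Properties as Unique
open import Data.Nat
open import Data.Nat.Properties
open import Algebra.Properties.CommutativeSemigroup *-commutativeSemigroup
  using (x∙yz≈y∙xz; xy∙z≈x∙zy) renaming (interchange to *-interchange)
open import Data.Nat.Coprimality
  using (Coprime; coprime-divisor; coprime-+; coprime⇒gcd≡1; gcd≡1⇒coprime)
  renaming (sym to coprime-sym)
open import Data.Nat.Divisibility
open import Data.Nat.DivMod using (_/_; _%_; m/n<m; m%n<n; m≡m%n+[m/n]*n)
open import Data.Nat.GCD using (gcd)
open import Data.Nat.Induction using (<-rec)
open import Data.Nat.LCM using (lcm; lcm-least; gcd*lcm; m∣lcm[m,n]; n∣lcm[m,n])
open import Data.Nat.ListAction using (product)
open import Data.Nat.ListAction.Properties using (product-++)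
open import Data.Nat.Primality using (Prime; prime?; prime⇒irreducible; prime⇒nonTrivial)
open import Data.Nat.Tactic.RingSolver using (solve-∀)
open import Data.Product using (∃-syntax; _×_; _,_; proj₁; proj₂)
open import Data.Sum using (inj₁; inj₂)
open import Relation.Binary.PropositionalEquality
  using (_≡_; _≢_; refl; sym; trans; cong; subst; subst₂; module ≡-Reasoning)
open import Relation.Nullary using (contradiction)
open import Relation.Nullary.Decidable using (¬?; _×-dec_)

open import Defs

^-distribʳ-* : ∀ m n o → (m * n) ^ o ≡ m ^ o * n ^ o
^-distribʳ-* m n zero    = refl
^-distribʳ-* m n (suc o) = begin
  m * n * (m * n) ^ o       ≡⟨ cong (m * n *_) (^-distribʳ-* m n o) ⟩
  m * n * (m ^ o * n ^ o)   ≡⟨ *-interchange m n (m ^ o) (n ^ o) ⟩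
  m * m ^ o * (n * n ^ o)   ∎
  where open ≡-Reasoning

[1+a]^j≤[1+j]*a^j : ∀ a j → j ≤ a → suc a ^ j ≤ suc j * a ^ j
[1+a]^j≤[1+j]*a^j a zero    _   = ≤-refl
[1+a]^j≤[1+j]*a^j a (suc j) j<a = begin
  suc a * suc a ^ j              ≤⟨ *-monoʳ-≤ (suc a) ([1+a]^j≤[1+j]*a^j a j (<⇒≤ j<a)) ⟩
  suc a * (suc j * a ^ j)        ≡⟨ expand a j (a ^ j) ⟩
  (suc j + a * suc j) * a ^ j    ≤⟨ *-monoˡ-≤ (a ^ j) (+-monoˡ-≤ (a * suc j) j<a) ⟩
  (a + a * suc j) * a ^ j        ≡⟨ collect a j (a ^ j) ⟩
  suc (suc j) * (a * a ^ j)      ∎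
  where
  open ≤-Reasoning
  expand : ∀ a j x → suc a * (suc j * x) ≡ (suc j + a * suc j) * x
  expand = solve-∀
  collect : ∀ a j x → (a + a * suc j) * x ≡ suc (suc j) * (a * x)
  collect = solve-∀

[1+t]^s≤[1+s]^t : ∀ {s t} → s ≤ t → suc t ^ s ≤ suc s ^ t
[1+t]^s≤[1+s]^t {s} s≤t with d , refl ← m≤n⇒∃[o]m+o≡n s≤t = go d
  where
  go : ∀ d → suc (s + d) ^ s ≤ suc s ^ (s + d)
  go zero    rewrite +-identityʳ s = ≤-refl
  go (suc d) rewrite +-suc s d = begin
    suc (suc (s + d)) ^ s     ≤⟨ [1+a]^j≤[1+j]*a^j (suc (s + d)) s (m≤n⇒m≤1+n (m≤m+n s d)) ⟩
    suc s * suc (s + d) ^ s   ≤⟨ *-monoʳ-≤ (suc s) (go d) ⟩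
    suc s * suc s ^ (s + d)   ∎
    where open ≤-Reasoning

[1+s][1+q]≤1+s+q[1+t] : ∀ {s t} q → s ≤ t → suc s * suc q ≤ suc (s + q * suc t)
[1+s][1+q]≤1+s+q[1+t] {s} {t} q s≤t = begin
  suc s * suc q             ≡⟨ expand s q ⟩
  suc (s + (q + q * s))     ≤⟨ s≤s (+-monoʳ-≤ s (+-monoʳ-≤ q (*-monoʳ-≤ q s≤t))) ⟩
  suc (s + (q + q * t))     ≡⟨ cong (λ w → suc (s + w)) (*-suc q t) ⟨
  suc (s + q * suc t)       ∎
  where
  open ≤-Reasoning
  expand : ∀ s q → suc s * suc q ≡ suc (s + (q + q * s))
  expand = solve-∀

p^q*q!∣[q*p]! : ∀ p q .{{_ : NonZero p}} → p ^ q * q ! ∣ (q * p) !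
p^q*q!∣[q*p]! p@(suc p-1) zero    = ∣-refl
p^q*q!∣[q*p]! p@(suc p-1) (suc q) = begin
  p ^ suc q * suc q !                 ≡⟨ regroup p (p ^ q) q (q !) ⟩
  p ^ q * q ! * (p + q * p)           ∣⟨ *-monoˡ-∣ (p + q * p) (p^q*q!∣[q*p]! p q) ⟩
  (q * p) ! * (p + q * p)             ≡⟨ *-comm ((q * p) !) (p + q * p) ⟩
  (p + q * p) * (q * p) !             ∣⟨ *-monoʳ-∣ (p + q * p) (m≤n⇒m!∣n! (m≤n+m (q * p) p-1)) ⟩
  (p + q * p) * (p-1 + q * p) !       ∎
  where
  open ∣-Reasoning
  regroup : ∀ p y q f → (p * y) * (f + q * f) ≡ (y * f) * (p + q * p)
  regroup = solve-∀

-- p^e (m+1) ≥ p^{m/(p−1)}, raised to the power p − 1 (for prime p, Legendre's formula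
-- identifies e with the exponent of p in m!).
LegendreBound : ℕ → ℕ → Set
LegendreBound p m = ∃[ e ] p ^ e ∣ m ! × p ^ m ≤ (p ^ e * suc m) ^ (p ∸ 1)

-- Writing m = s + q p with s < p, the bound for m follows from the bound for q = ⌊m/p⌋,
-- with e(m) = q + e(q).
legendreBound-step : ∀ {s t} q e → s ≤ t → suc t ^ q ≤ (suc t ^ e * suc q) ^ t →
  suc t ^ (s + q * suc t) ≤ (suc t ^ (q + e) * suc (s + q * suc t)) ^ t
legendreBound-step {s} {t} q e s≤t bound-q = begin
  p ^ (s + q * p)                          ≡⟨ split-exponent ⟩
  p ^ s * (p ^ q * (p ^ q) ^ t)
    ≤⟨ *-mono-≤ ([1+t]^s≤[1+s]^t s≤t) (*-monoˡ-≤ ((p ^ q) ^ t) bound-q) ⟩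
  suc s ^ t * ((p ^ e * suc q) ^ t * (p ^ q) ^ t)
    ≡⟨ cong (suc s ^ t *_) (^-distribʳ-* (p ^ e * suc q) (p ^ q) t) ⟨
  suc s ^ t * (p ^ e * suc q * p ^ q) ^ t  ≡⟨ ^-distribʳ-* (suc s) (p ^ e * suc q * p ^ q) t ⟨
  (suc s * (p ^ e * suc q * p ^ q)) ^ t    ≡⟨ cong (_^ t) regroup ⟩
  (p ^ (q + e) * (suc s * suc q)) ^ t
    ≤⟨ ^-monoˡ-≤ t (*-monoʳ-≤ (p ^ (q + e)) ([1+s][1+q]≤1+s+q[1+t] q s≤t)) ⟩
  (p ^ (q + e) * suc (s + q * p)) ^ t      ∎
  where
  open ≤-Reasoning
  p = suc t
  split-exponent : p ^ (s + q * p) ≡ p ^ s * (p ^ q * (p ^ q) ^ t)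
  split-exponent = begin-equality
    p ^ (s + q * p)                ≡⟨ ^-distribˡ-+-* p s (q * p) ⟩
    p ^ s * p ^ (q * p)            ≡⟨ cong (λ w → p ^ s * p ^ w) (*-suc q t) ⟩
    p ^ s * p ^ (q + q * t)        ≡⟨ cong (p ^ s *_) (^-distribˡ-+-* p q (q * t)) ⟩
    p ^ s * (p ^ q * p ^ (q * t))  ≡⟨ cong (λ w → p ^ s * (p ^ q * w)) (^-*-assoc p q t) ⟨
    p ^ s * (p ^ q * (p ^ q) ^ t)  ∎
  rearrange : ∀ a b c d → a * (b * c * d) ≡ d * b * (a * c)
  rearrange = solve-∀
  regroup : suc s * (p ^ e * suc q * p ^ q) ≡ p ^ (q + e) * (suc s * suc q)
  regroup = trans (rearrange (suc s) (p ^ e) (suc q) (p ^ q))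
                  (cong (_* (suc s * suc q)) (sym (^-distribˡ-+-* p q e)))

legendreBound-1+ : ∀ t .{{_ : NonZero t}} m → LegendreBound (suc t) m
legendreBound-1+ t = <-rec (LegendreBound p) bound
  where
  p = suc t
  bound : ∀ m → (∀ {m′} → m′ < m → LegendreBound p m′) → LegendreBound p m
  bound zero      _   = 0 , ∣-refl , ≤-reflexive (sym (^-zeroˡ t))
  bound m@(suc _) rec = q + e , p^[q+e]∣m! , bound-m
    where
    q = m / p
    s = m % p
    m≡s+q*p : m ≡ s + q * p
    m≡s+q*p = m≡m%n+[m/n]*n m p
    IH : LegendreBound p q
    IH = rec (m/n<m m p (s≤s (>-nonZero⁻¹ t)))
    e = proj₁ IH
    p^[q+e]∣m! : p ^ (q + e) ∣ m !
    p^[q+e]∣m! = begin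
      p ^ (q + e)      ≡⟨ ^-distribˡ-+-* p q e ⟩
      p ^ q * p ^ e    ∣⟨ *-monoʳ-∣ (p ^ q) (proj₁ (proj₂ IH)) ⟩
      p ^ q * q !      ∣⟨ p^q*q!∣[q*p]! p q ⟩
      (q * p) !        ∣⟨ m≤n⇒m!∣n! (subst (q * p ≤_) (sym m≡s+q*p) (m≤n+m (q * p) s)) ⟩
      m !              ∎
      where open ∣-Reasoning
    bound-m : p ^ m ≤ (p ^ (q + e) * suc m) ^ t
    bound-m = subst (λ w → p ^ w ≤ (p ^ (q + e) * suc w) ^ t) (sym m≡s+q*p)
                (legendreBound-step q e (m<1+n⇒m≤n (m%n<n m p)) (proj₂ (proj₂ IH)))

legendreBound : ∀ p m → LegendreBound p m
legendreBound zero          zero    = 0 , ∣-refl , ≤-refl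
legendreBound zero          (suc m) = 0 , 1∣ _ , z≤n
legendreBound (suc zero)    m       = 0 , 1∣ _ , ≤-reflexive (^-zeroˡ m)
legendreBound (suc (suc t)) m       = legendreBound-1+ (suc t) m

product-applyUpTo-∷ʳ : ∀ (f : ℕ → ℕ) n →
  product (applyUpTo f (suc n)) ≡ product (applyUpTo f n) * f n
product-applyUpTo-∷ʳ f n = begin
  product (applyUpTo f (suc n))        ≡⟨ cong product (applyUpTo-∷ʳ f n) ⟨
  product (applyUpTo f n ∷ʳ f n)       ≡⟨ product-++ (applyUpTo f n) [ f n ] ⟩
  product (applyUpTo f n) * (f n * 1)  ≡⟨ cong (product (applyUpTo f n) *_) (*-identityʳ (f n)) ⟩
  product (applyUpTo f n) * f n        ∎
  where open ≡-Reasoning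

product-map-mono-≤ : ∀ {f g : ℕ → ℕ} {xs} → All (λ x → f x ≤ g x) xs →
  product (map f xs) ≤ product (map g xs)
product-map-mono-≤ []              = ≤-refl
product-map-mono-≤ (fx≤gx ∷ f≤g) = *-mono-≤ fx≤gx (product-map-mono-≤ f≤g)

product-map-* : ∀ (f g : ℕ → ℕ) xs →
  product (map (λ x → f x * g x) xs) ≡ product (map f xs) * product (map g xs)
product-map-* f g []       = refl
product-map-* f g (x ∷ xs) = trans (cong (f x * g x *_) (product-map-* f g xs))
  (*-interchange (f x) (g x) (product (map f xs)) (product (map g xs)))

product-map-const : ∀ c (xs : List ℕ) → product (map (λ _ → c) xs) ≡ c ^ length xs
product-map-const c []       = refl
product-map-const c (_ ∷ xs) = cong (c *_) (product-map-const c xs)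

product-map-^ : ∀ (f : ℕ → ℕ) n xs → product (map (λ x → f x ^ n) xs) ≡ product (map f xs) ^ n
product-map-^ f n []       = sym (^-zeroˡ n)
product-map-^ f n (x ∷ xs) = trans (cong (f x ^ n *_) (product-map-^ f n xs))
  (sym (^-distribʳ-* (f x) (product (map f xs)) n))

product-map-split : ∀ (f : ℕ → ℕ) {x xs} → Unique xs → x ∈ xs →
  product (map f xs) ≡ f x * product (map f (filter (λ y → ¬? (y ≟ x)) xs))
product-map-split f {x} {_ ∷ ys} (x∉ys ∷ _) (here refl) =
  cong (λ zs → f x * product (map f zs)) (sym without-x)
  where
  P? = λ y → ¬? (y ≟ x)
  without-x : filter P? (x ∷ ys) ≡ ys
  without-x = trans (filter-reject P? (λ x≢x → x≢x refl))
                    (filter-all P? (All.map (λ x≢y y≡x → x≢y (sym y≡x)) x∉ys))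
product-map-split f {x} {y ∷ ys} (y∉ys ∷ unique) (there x∈ys) = begin
  f y * product (map f ys)                    ≡⟨ cong (f y *_) (product-map-split f unique x∈ys) ⟩
  f y * (f x * product (map f (filter P? ys))) ≡⟨ x∙yz≈y∙xz (f y) (f x) _ ⟩
  f x * (f y * product (map f (filter P? ys)))
    ≡⟨ cong (λ zs → f x * product (map f zs)) (filter-accept P? (All.lookup y∉ys x∈ys)) ⟨
  f x * product (map f (filter P? (y ∷ ys)))   ∎
  where
  open ≡-Reasoning
  P? = λ z → ¬? (z ≟ x)

-- The induction step is the partial-fraction identity
--   1/(f₀⋯f_{m+1}) = (1/(f₀⋯f_m) − 1/(f₁⋯f_{m+1})) / (f_{m+1} − f₀),  f_{m+1} − f₀ = (m+1) r,
-- taken in the form f₀⋯f_{m+1} ∣ N f_{m+1} m! r^m  and  f₀⋯f_{m+1} ∣ N f₀ m! r^m.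
progression-product-∣ : ∀ m {x r N} (f : ℕ → ℕ) → (∀ j → f j ≡ x + j * r) →
  (∀ j → j ≤ m → f j ∣ N) → product (applyUpTo f (suc m)) ∣ N * (m ! * r ^ m)
progression-product-∣ zero {N = N} f _ f∣N =
  subst₂ _∣_ (sym (*-identityʳ (f 0))) (sym (*-identityʳ N)) (f∣N 0 z≤n)
progression-product-∣ (suc m) {x} {r} {N} f f≡ f∣N =
  subst (Q ∣_) (cong (N *_) (*-interchange (suc m) r (m !) (r ^ m)))
    (∣m+n∣m⇒∣n (subst (Q ∣_) split ∣last) ∣first)
  where
  open ∣-Reasoning
  Q = product (applyUpTo f (suc (suc m)))
  K = m ! * r ^ m
  ∣first : Q ∣ N * (x * K)
  ∣first = begin
    f 0 * product (applyUpTo (λ j → f (suc j)) (suc m))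
      ∣⟨ *-monoʳ-∣ (f 0) (progression-product-∣ m (λ j → f (suc j)) f≡∘suc (λ j j≤m → f∣N (suc j) (s≤s j≤m))) ⟩
    f 0 * (N * K)    ≡⟨ x∙yz≈y∙xz (f 0) N K ⟩
    N * (f 0 * K)    ≡⟨ cong (λ y → N * (y * K)) (trans (f≡ 0) (+-identityʳ x)) ⟩
    N * (x * K)      ∎
    where
    f≡∘suc : ∀ j → f (suc j) ≡ (x + r) + j * r
    f≡∘suc j = trans (f≡ (suc j)) (sym (+-assoc x r (j * r)))
  ∣last : Q ∣ N * ((x + suc m * r) * K)
  ∣last = begin
    Q                                    ≡⟨ product-applyUpTo-∷ʳ f (suc m) ⟩
    product (applyUpTo f (suc m)) * f (suc m)
      ∣⟨ *-monoˡ-∣ (f (suc m)) (progression-product-∣ m f f≡ (λ j j≤m → f∣N j (m≤n⇒m≤1+n j≤m))) ⟩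
    N * K * f (suc m)                    ≡⟨ xy∙z≈x∙zy N K (f (suc m)) ⟩
    N * (f (suc m) * K)                  ≡⟨ cong (λ y → N * (y * K)) (f≡ (suc m)) ⟩
    N * ((x + suc m * r) * K)            ∎
  split : N * ((x + suc m * r) * K) ≡ N * (x * K) + N * (suc m * r * K)
  split = trans (cong (N *_) (*-distribʳ-+ K x (suc m * r))) (*-distribˡ-+ N (x * K) (suc m * r * K))

coprime-1 : ∀ {a} → Coprime a 1
coprime-1 (_ , d∣1) = ∣1⇒≡1 d∣1

coprime-* : ∀ {a b c} → Coprime a b → Coprime a c → Coprime a (b * c)
coprime-* a⊥b a⊥c (d∣a , d∣bc) =
  a⊥c (d∣a , coprime-divisor (λ (x∣d , x∣b) → a⊥b (∣-trans x∣d d∣a , x∣b)) d∣bc)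

coprime-^ : ∀ {a b} e → Coprime a b → Coprime a (b ^ e)
coprime-^ zero    _   = coprime-1
coprime-^ (suc e) a⊥b = coprime-* a⊥b (coprime-^ e a⊥b)

coprime-^-^ : ∀ {a b} i j → Coprime a b → Coprime (a ^ i) (b ^ j)
coprime-^-^ i j a⊥b = coprime-sym (coprime-^ i (coprime-sym (coprime-^ j a⊥b)))

coprime-∣ : ∀ {a b c} → Coprime a b → c ∣ b → Coprime a c
coprime-∣ a⊥b c∣b (d∣a , d∣c) = a⊥b (d∣a , ∣-trans d∣c c∣b)

coprime-product : ∀ {a xs} → All (Coprime a) xs → Coprime a (product xs)
coprime-product []            = coprime-1
coprime-product (a⊥x ∷ a⊥xs) = coprime-* a⊥x (coprime-product a⊥xs)

coprime-+-* : ∀ {x r} j → Coprime x r → Coprime (x + j * r) r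
coprime-+-* {x} {r} zero    x⊥r = subst (λ y → Coprime y r) (sym (+-identityʳ x)) x⊥r
coprime-+-* {x} {r} (suc j) x⊥r =
  subst (λ y → Coprime y r) (+-comm-middle r x (j * r)) (coprime-+ (coprime-+-* j x⊥r))
  where
  +-comm-middle : ∀ a b c → a + (b + c) ≡ b + (a + c)
  +-comm-middle = solve-∀

coprime-∣-cancel : ∀ {P B c n N} → Coprime P (B * c) → B ∣ n → P ∣ N * (n * c) → P * B ∣ N * n
coprime-∣-cancel {P} {B} {c} {N = N} P⊥Bc (divides a refl) P∣N[aBc] = begin
  P * B          ∣⟨ *-monoˡ-∣ B (coprime-divisor P⊥Bc (subst (P ∣_) (reorder N a B c) P∣N[aBc])) ⟩
  N * a * B      ≡⟨ *-assoc N a B ⟩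
  N * (a * B)    ∎
  where
  open ∣-Reasoning
  reorder : ∀ l a b c → l * (a * b * c) ≡ b * c * (l * a)
  reorder = solve-∀

distinct-primes-coprime : ∀ {p q} → Prime p → Prime q → p ≢ q → Coprime p q
distinct-primes-coprime p-prime q-prime p≢q (d∣p , d∣q) with prime⇒irreducible p-prime d∣p
... | inj₁ d≡1 = d≡1
... | inj₂ refl with prime⇒irreducible q-prime d∣q
...   | inj₁ refl = contradiction refl (nonTrivial⇒≢1 {{prime⇒nonTrivial p-prime}})
...   | inj₂ refl = contradiction refl p≢q

distinct-primes-pairwiseCoprime : ∀ {ps} → All Prime ps → Unique ps → AllPairs Coprime ps
distinct-primes-pairwiseCoprime {[]}    []                 []              = []
distinct-primes-pairwiseCoprime {p ∷ _} (p-prime ∷ primes) (p∉ps ∷ unique) =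
  All.zipWith coprime-to-p (primes , p∉ps) ∷ distinct-primes-pairwiseCoprime primes unique
  where
  coprime-to-p : ∀ {q} → Prime q × p ≢ q → Coprime p q
  coprime-to-p (q-prime , p≢q) = distinct-primes-coprime p-prime q-prime p≢q

coprime⇒lcm≡* : ∀ {a b} → Coprime a b → lcm a b ≡ a * b
coprime⇒lcm≡* {a} {b} a⊥b = begin
  lcm a b            ≡⟨ *-identityˡ (lcm a b) ⟨
  1 * lcm a b        ≡⟨ cong (_* lcm a b) (coprime⇒gcd≡1 a⊥b) ⟨
  gcd a b * lcm a b  ≡⟨ gcd*lcm a b ⟩
  a * b              ∎
  where open ≡-Reasoning

pairwiseCoprime-product-∣ : ∀ {n xs} → AllPairs Coprime xs → All (_∣ n) xs → product xs ∣ n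
pairwiseCoprime-product-∣ []                  []             = 1∣ _
pairwiseCoprime-product-∣ (x⊥xs ∷ xs-coprime) (x∣n ∷ xs∣n) =
  subst (_∣ _) (coprime⇒lcm≡* (coprime-product x⊥xs))
    (lcm-least x∣n (pairwiseCoprime-product-∣ xs-coprime xs∣n))

lcm-nonZero : ∀ a b .{{_ : NonZero a}} .{{_ : NonZero b}} → NonZero (lcm a b)
lcm-nonZero a b = ≢-nonZero λ lcm≡0 → ≢-nonZero⁻¹ (a * b) {{m*n≢0 a b}} (begin
  a * b              ≡⟨ gcd*lcm a b ⟨
  gcd a b * lcm a b  ≡⟨ cong (gcd a b *_) lcm≡0 ⟩
  gcd a b * 0        ≡⟨ *-zeroʳ (gcd a b) ⟩
  0                  ∎)
  where open ≡-Reasoning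

lcmList-nonZero : ∀ {xs} → All NonZero xs → NonZero (lcmList xs)
lcmList-nonZero []                = _
lcmList-nonZero (x≢0 ∷ xs≢0) = lcm-nonZero _ _ {{x≢0}} {{lcmList-nonZero xs≢0}}

lcmList-∣ : ∀ {x xs} → x ∈ xs → x ∣ lcmList xs
lcmList-∣ {xs = y ∷ ys} (here refl)  = m∣lcm[m,n] y (lcmList ys)
lcmList-∣ {xs = y ∷ ys} (there x∈ys) = ∣-trans (lcmList-∣ x∈ys) (n∣lcm[m,n] y (lcmList ys))

L-nonZero : ∀ {u₀} r n → 1 ≤ u₀ → NonZero (L u₀ r n)
L-nonZero {u₀} r n 1≤u₀ = lcmList-nonZero
  (All.map⁺ (All.universal (λ j → >-nonZero (≤-trans 1≤u₀ (m≤m+n u₀ (j * r)))) (upTo (suc n))))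

prodFrom-∣ : ∀ u₀ r {n k} → k ≤ n → prodFrom u₀ r k n ∣ L u₀ r n * ((n ∸ k) ! * r ^ (n ∸ k))
prodFrom-∣ u₀ r {n} {k} k≤n = ∣-trans (∣-reflexive (cong product (map-upTo u[k+] (suc (n ∸ k)))))
  (progression-product-∣ (n ∸ k) u[k+] u[k+j]≡ u[k+j]∣L)
  where
  u[k+] : ℕ → ℕ
  u[k+] j = u u₀ r (k + j)
  u[k+j]≡ : ∀ j → u[k+] j ≡ (u₀ + k * r) + j * r
  u[k+j]≡ j = trans (cong (u₀ +_) (*-distribʳ-+ r k j)) (sym (+-assoc u₀ (k * r) (j * r)))
  u[k+j]∣L : ∀ j → j ≤ n ∸ k → u[k+] j ∣ L u₀ r n
  u[k+j]∣L j j≤n∸k = lcmList-∣ (∈-map⁺ (u u₀ r) (∈-upTo⁺ (s≤s k+j≤n)))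
    where
    k+j≤n : k + j ≤ n
    k+j≤n = subst (k + j ≤_) (m+[n∸m]≡n k≤n) (+-monoʳ-≤ k j≤n∸k)

prodFrom-coprime : ∀ u₀ r k n → gcd u₀ r ≡ 1 → Coprime (prodFrom u₀ r k n) r
prodFrom-coprime u₀ r k n gcd≡1 =
  coprime-sym (coprime-product (All.map⁺ (All.universal r⊥u[k+j] (upTo (suc (n ∸ k))))))
  where
  r⊥u[k+j] : ∀ j → Coprime r (u u₀ r (k + j))
  r⊥u[k+j] j = coprime-sym (coprime-+-* (k + j) (gcd≡1⇒coprime gcd≡1))

primeDivisors-prime-∣ : ∀ r → All (λ p → Prime p × p ∣ r) (primeDivisors r)
primeDivisors-prime-∣ r = All.all-filter (λ p → prime? p ×-dec (p ∣? r)) (upTo (suc r))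

primeDivisors-unique : ∀ r → Unique (primeDivisors r)
primeDivisors-unique r = Unique.filter⁺ (λ p → prime? p ×-dec (p ∣? r)) (Unique.upTo⁺ (suc r))

primeDivisorPowers : ℕ → (ℕ → ℕ) → ℕ
primeDivisorPowers r e = product (map (λ p → p ^ e p) (primeDivisors r))

primeDivisorPowers-∣ : ∀ r {e n} → (∀ p → p ^ e p ∣ n) → primeDivisorPowers r e ∣ n
primeDivisorPowers-∣ r {e} p^e∣n = pairwiseCoprime-product-∣
  (AllPairs.map⁺ (AllPairs.map (λ {p} {q} → coprime-^-^ (e p) (e q))
    (distinct-primes-pairwiseCoprime (All.map proj₁ (primeDivisors-prime-∣ r)) (primeDivisors-unique r))))
  (All.map⁺ (All.universal p^e∣n (primeDivisors r)))

coprime-primeDivisorPowers : ∀ {a r} e → Coprime a r → Coprime a (primeDivisorPowers r e)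
coprime-primeDivisorPowers {a} {r} e a⊥r =
  coprime-product (All.map⁺ (All.map a⊥p^e (primeDivisors-prime-∣ r)))
  where
  a⊥p^e : ∀ {p} → Prime p × p ∣ r → Coprime a (p ^ e p)
  a⊥p^e (_ , p∣r) = coprime-^ (e _) (coprime-∣ a⊥r p∣r)

prodFrom*primeDivisorPowers-∣ : ∀ u₀ r {n k} e → gcd u₀ r ≡ 1 → k ≤ n →
  (∀ p → p ^ e p ∣ (n ∸ k) !) → prodFrom u₀ r k n * primeDivisorPowers r e ∣ L u₀ r n * (n ∸ k) !
prodFrom*primeDivisorPowers-∣ u₀ r {n} {k} e gcd≡1 k≤n p^e∣m! =
  coprime-∣-cancel {N = L u₀ r n}
    (coprime-* (coprime-primeDivisorPowers e P⊥r) (coprime-^ (n ∸ k) P⊥r))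
    (primeDivisorPowers-∣ r {e} p^e∣m!)
    (prodFrom-∣ u₀ r k≤n)
  where
  P⊥r : Coprime (prodFrom u₀ r k n) r
  P⊥r = prodFrom-coprime u₀ r k n gcd≡1

denom≡[p-1]*others : ∀ {r p} → p ∈ primeDivisors r → denom r ≡ (p ∸ 1) * others r p
denom≡[p-1]*others {r} = product-map-split (λ q → q ∸ 1) (primeDivisors-unique r)

primePowProd-≤ : ∀ r m e → (∀ p → p ^ m ≤ (p ^ e p * suc m) ^ (p ∸ 1)) →
  primePowProd r m ≤ (primeDivisorPowers r e * suc m ^ ω r) ^ denom r
primePowProd-≤ r m e bound = begin
  primePowProd r m                                   ≤⟨ product-map-mono-≤ (All.tabulate bound-p) ⟩
  product (map (λ p → (p ^ e p * suc m) ^ D) ps)     ≡⟨ product-map-^ (λ p → p ^ e p * suc m) D ps ⟩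
  product (map (λ p → p ^ e p * suc m) ps) ^ D       ≡⟨ cong (_^ D) (product-map-* (λ p → p ^ e p) (λ _ → suc m) ps) ⟩
  (primeDivisorPowers r e * product (map (λ _ → suc m) ps)) ^ D
    ≡⟨ cong (λ w → (primeDivisorPowers r e * w) ^ D) (product-map-const (suc m) ps) ⟩
  (primeDivisorPowers r e * suc m ^ ω r) ^ D         ∎
  where
  open ≤-Reasoning
  ps = primeDivisors r
  D = denom r
  bound-p : ∀ {p} → p ∈ ps → p ^ (m * others r p) ≤ (p ^ e p * suc m) ^ D
  bound-p {p} p∈ps = begin
    p ^ (m * others r p)                       ≡⟨ ^-*-assoc p m (others r p) ⟨
    (p ^ m) ^ others r p                       ≤⟨ ^-monoˡ-≤ (others r p) (bound p) ⟩
    ((p ^ e p * suc m) ^ (p ∸ 1)) ^ others r p ≡⟨ ^-*-assoc _ (p ∸ 1) (others r p) ⟩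
    (p ^ e p * suc m) ^ ((p ∸ 1) * others r p) ≡⟨ cong ((p ^ e p * suc m) ^_) (denom≡[p-1]*others {r} p∈ps) ⟨
    (p ^ e p * suc m) ^ D                      ∎

theorem3p1 : (u₀ r n k : ℕ) → 1 ≤ u₀ → 1 ≤ r → gcd u₀ r ≡ 1 → k ≤ n →
    prodFrom u₀ r k n ^ denom r * primePowProd r (n ∸ k)
      ≤ (L u₀ r n * (n ∸ k) ! * suc (n ∸ k) ^ ω r) ^ denom r
theorem3p1 u₀ r n k 1≤u₀ _ gcd≡1 k≤n = begin
  P ^ D * primePowProd r m  ≤⟨ *-monoʳ-≤ (P ^ D) (primePowProd-≤ r m e p^m≤[p^e[1+m]]^[p-1]) ⟩
  P ^ D * (B * W) ^ D       ≡⟨ ^-distribʳ-* P (B * W) D ⟨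
  (P * (B * W)) ^ D         ≡⟨ cong (_^ D) (*-assoc P B W) ⟨
  (P * B * W) ^ D           ≤⟨ ^-monoˡ-≤ D (*-monoˡ-≤ W (∣⇒≤ {{L*m!≢0}} P*B∣L*m!)) ⟩
  (L u₀ r n * m ! * W) ^ D  ∎
  where
  open ≤-Reasoning
  m = n ∸ k
  D = denom r
  P = prodFrom u₀ r k n
  e : ℕ → ℕ
  e p = proj₁ (legendreBound p m)
  B = primeDivisorPowers r e
  W = suc m ^ ω r
  p^e∣m! : ∀ p → p ^ e p ∣ m !
  p^e∣m! p = proj₁ (proj₂ (legendreBound p m))
  p^m≤[p^e[1+m]]^[p-1] : ∀ p → p ^ m ≤ (p ^ e p * suc m) ^ (p ∸ 1)
  p^m≤[p^e[1+m]]^[p-1] p = proj₂ (proj₂ (legendreBound p m))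
  P*B∣L*m! : P * B ∣ L u₀ r n * m !
  P*B∣L*m! = prodFrom*primeDivisorPowers-∣ u₀ r e gcd≡1 k≤n p^e∣m!
  L*m!≢0 : NonZero (L u₀ r n * m !)
  L*m!≢0 = m*n≢0 _ _ {{L-nonZero r n 1≤u₀}} {{m !≢0}}
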